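{- Let $q$ be a prime with $q\equiv 3 \pmod 8$, let $\alpha\in\mathbb{Z}_q$ be a generator of the multiplicative group $QR(q)$ of nonzero quadratic residues modulo $q$, and let $\beta\in\{2,\frac{q+1}{2}\}$. Then the set $$S_\beta=\left\{\{\alpha,\beta\alpha\},\{\alpha^2,\beta\alpha^2\},\ldots,\{\alpha^{\frac{q-1}{2}},\beta\alpha^{\frac{q-1}{2}}\}\right\}$$ (with all arithmetic in $\mathbb{Z}_q$) is a strong starter for $\mathbb{Z}_q$ that is Skolem; i.e., $S_\beta$ is a strong Skolem starter for $\mathbb{Z}_q$.
   Context: Let $G$ be a finite additive abelian group of odd order $n=2t+1$ and $G^*=G\setminus\{0\}$. A starter for $G$ is a set $S=\{\{x_1,y_1\},\ldots,\{x_t,y_t\}\}$ of unordered pairs such that $\{x_1,\ldots,x_t,y_1,\ldots,y_t\}=G^*$ and $\{\pm(x_i-y_i): i=1,\ldots,t\}=G^*$. It is a strong starter if moreover the sums $x_1+y_1,\ldots,x_t+y_t$ are pairwise distinct (i.e. $|\{x_i+y_i\}|=t$). For $G=\mathbb{Z}_n$, identify the nonzero elements with the integers $1,\ldots,2t$ ordered by $1<2<\cdots<2t$. A starter for $\mathbb{Z}_n$ is Skolem if its pairs can be written as $\{x_i,y_i\}$, $i=1,\ldots,t$, with $y_i>x_i$ (in this order) and $y_i-x_i\equiv i \pmod n$ for each $i=1,\ldots,t$. A strong Skolem starter is a starter that is both strong and Skolem. $QR(q)$ denotes the set of nonzero squares in $\mathbb{Z}_q$, a cyclic group of order $\frac{q-1}{2}$.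 -}

module Defs where

open import Data.Nat using (ℕ; zero; suc; _+_; _*_; _∸_; _^_; _<_; _≤_)
open import Data.Nat.DivMod using (_%_)
open import Data.Fin using (Fin; toℕ)
open import Data.Product using (_×_; _,_; proj₁; proj₂; ∃; ∃-syntax; Σ)
open import Data.Sum using (_⊎_)
open import Relation.Binary.PropositionalEquality using (_≡_; _≢_)
open import Function.Bundles using (_↔_; Inverse)

-- The group Z_n with n = 2t+1; elements are represented by naturals 0..n-1.
-- All groups below have odd order n = ord t = 2t+1.
ord : ℕ → ℕ
ord t = suc (2 * t)

NonZeroElt : ℕ → ℕ → Set
NonZeroElt t g = (1 ≤ g) × (g < ord t)

subMod : ℕ → ℕ → ℕ → ℕ
subMod t x y = (x + (ord t ∸ (y % ord t))) % ord t

addMod : ℕ → ℕ → ℕ → ℕ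
addMod t x y = (x + y) % ord t

-- A family of t unordered pairs {x_i , y_i} of Z_(2t+1), indexed by Fin t.
Pairs : ℕ → Set
Pairs t = Fin t → ℕ × ℕ

_≈ᵤ_ : ℕ × ℕ → ℕ × ℕ → Set
(a , b) ≈ᵤ (c , d) = ((a ≡ c) × (b ≡ d)) ⊎ ((a ≡ d) × (b ≡ c))

-- Starter: {x_1,…,x_t,y_1,…,y_t} = G*  and  {±(x_i - y_i)} = G*  (set equalities).
IsStarter : (t : ℕ) → Pairs t → Set
IsStarter t S =
  ((i : Fin t) → NonZeroElt t (proj₁ (S i)) × NonZeroElt t (proj₂ (S i)))
  × ((g : ℕ) → NonZeroElt t g →
       ∃[ i ] ((proj₁ (S i) ≡ g) ⊎ (proj₂ (S i) ≡ g)))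
  × ((i : Fin t) →
       NonZeroElt t (subMod t (proj₁ (S i)) (proj₂ (S i)))
     × NonZeroElt t (subMod t (proj₂ (S i)) (proj₁ (S i))))
  × ((g : ℕ) → NonZeroElt t g →
       ∃[ i ] ((subMod t (proj₁ (S i)) (proj₂ (S i)) ≡ g)
              ⊎ (subMod t (proj₂ (S i)) (proj₁ (S i)) ≡ g)))

IsStrong : (t : ℕ) → Pairs t → Set
IsStrong t S = (i j : Fin t) →
  addMod t (proj₁ (S i)) (proj₂ (S i)) ≡ addMod t (proj₁ (S j)) (proj₂ (S j)) → i ≡ j

-- Skolem: the pairs can be enumerated (via a bijection π : Fin t ↔ Fin t, the
-- i-th pair being S (π i), for i = 1,…,t) as {x_i, y_i} with x_i < y_i (as
-- integers in 1..2t) and y_i - x_i ≡ i (mod n).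
IsSkolem : (t : ℕ) → Pairs t → Set
IsSkolem t S = Σ (Fin t ↔ Fin t) λ π → (i : Fin t) →
  ∃[ x ] ∃[ y ] ((S (Inverse.to π i) ≈ᵤ (x , y))
                 × (x < y)
                 × ((y ∸ x) % ord t ≡ suc (toℕ i) % ord t))

IsStrongSkolemStarter : (t : ℕ) → Pairs t → Set
IsStrongSkolemStarter t S = IsStarter t S × IsStrong t S × IsSkolem t S

IsQR : (t : ℕ) → ℕ → Set
IsQR t x = (x % ord t ≢ 0) × (∃[ y ] ((y * y) % ord t ≡ x % ord t))

IsQRGenerator : (t : ℕ) → ℕ → Set
IsQRGenerator t α = IsQR t α × ((x : ℕ) → IsQR t x → ∃[ k ] ((α ^ k) % ord t ≡ x % ord t))

-- S_β = { {α^k, β α^k} : k = 1,…,t }, the pair indexed by i : Fin t has k = i+1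
Sβ : (t α β : ℕ) → Pairs t
Sβ t α β i = ((α ^ suc (toℕ i)) % ord t , (β * α ^ suc (toℕ i)) % ord t)

module Submission where

open import Defs
open import Data.Nat using (ℕ; _<_; _+_)
open import Data.Nat.DivMod using (_%_; _/_)
open import Data.Nat.Primality using (Prime)
open import Data.Sum using (_⊎_)
open import Relation.Binary.PropositionalEquality using (_≡_)

open import Data.Nat.Base
open import Data.Nat.Properties
open import Data.Nat.DivMod
open import Data.Nat.Divisibility using (_∣_; m%n≡0⇒n∣m; n∣m⇒m%n≡0)
open import Data.Nat.Primality using (euclidsLemma; prime⇒nonZero; prime⇒nonTrivial)
open import Data.Nat.Tactic.RingSolver using (solve-∀)
open import Data.Fin as Fin using (Fin; toℕ; fromℕ<; punchOut; splitAt; join)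
import Data.Fin.Properties as Finₚ
open import Data.Sum using (inj₁; inj₂; [_,_]′; map₂)
open import Data.Product using (_×_; _,_; proj₁; proj₂; ∃; ∃₂; ∃-syntax; Σ)
open import Data.Empty using (⊥; ⊥-elim)
open import Function.Base using (_∘_; id)
open import Function.Bundles using (_↔_; mk↔ₛ′)
open import Function.Definitions using (Injective)
open import Level using (0ℓ)
open import Relation.Nullary using (¬_; yes; no)
open import Relation.Binary.Bundles using (Setoid)
open import Relation.Binary.Structures using (IsEquivalence)
open import Relation.Binary.Definitions using (tri<; tri≈; tri>)
import Relation.Binary.Reasoning.Setoid as SetoidReasoning
open import Relation.Binary.PropositionalEquality
  using (_≢_; refl; sym; trans; cong; cong₂; subst; module ≡-Reasoning)

-- The argument rests on three facts about Z_q: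
--  * ⟨α⟩ = QR(q) consists of the t distinct powers α, …, α^t, and α^t = 1
--    (both by comparing ⟨α⟩ with the t distinct squares 1², …, t²);
--  * −1 and 2 are non-residues (t is odd; Gauss' lemma gives 2^t ≡ −1),
--    hence so is β ∈ {2, 2⁻¹};
--  * for a non-residue ρ the 2t numbers α^k, ρα^k are pairwise distinct.
-- Thus the entries α^k, βα^k of S_β and its differences ±(1−β)α^k are each
-- 2t distinct non-zero residues, i.e. all of G* (starter); the sums
-- (1+β)α^k are distinct (strong); and every pair is {u, 2u} with u = cα^k
-- (c = 1 or c = β), whose natural orientation has length ±u ∈ {1,…,t};
-- these lengths are distinct, hence enumerate {1,…,t} (Skolem).

Oriented : ℕ × ℕ → ℕ → Set
Oriented p D = ∃[ x ] ∃[ y ] ((p ≈ᵤ (x , y)) × (x < y) × (y ∸ x ≡ D))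

oriented-swap : ∀ {u v D} → Oriented (u , v) D → Oriented (v , u) D
oriented-swap (x , y , inj₁ (u≡x , v≡y) , x<y , len) = x , y , inj₂ (v≡y , u≡x) , x<y , len
oriented-swap (x , y , inj₂ (u≡y , v≡x) , x<y , len) = x , y , inj₁ (v≡x , u≡y) , x<y , len

-- An injective endomap of Fin n is onto: a missed value would let us
-- squeeze Fin (suc m) injectively into Fin m.
injective⇒surjective : ∀ {n} (f : Fin n → Fin n) → Injective _≡_ _≡_ f →
                       ∀ j → ∃ λ i → f i ≡ j
injective⇒surjective {suc m} f f-inj j with Finₚ.any? (λ i → f i Finₚ.≟ j)
... | yes hit  = hit
... | no  miss = ⊥-elim (1+n≰n (Finₚ.injective⇒≤ squeeze-injective))
  where
    squeeze : Fin (suc m) → Fin m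
    squeeze i = punchOut {i = j} (λ j≡fi → miss (i , sym j≡fi))
    squeeze-injective : Injective _≡_ _≡_ squeeze
    squeeze-injective eq = f-inj (Finₚ.punchOut-injective {i = j} _ _ eq)

-- A number y ∈ {1,…,n}, seen as the element y − 1 of Fin n.
fromPositive : ∀ {n} y → 1 ≤ y → y ≤ n → Fin n
fromPositive (suc y) _ y<n = fromℕ< y<n

suc-toℕ-fromPositive : ∀ {n} y (1≤y : 1 ≤ y) (y≤n : y ≤ n) →
                       suc (toℕ (fromPositive y 1≤y y≤n)) ≡ y
suc-toℕ-fromPositive (suc y) _ y<n = cong suc (Finₚ.toℕ-fromℕ< y<n)

fill : ∀ {n} (h : Fin n → ℕ) → (∀ i → 1 ≤ h i) → (∀ i → h i ≤ n) →
       Injective _≡_ _≡_ h → ∀ g → 1 ≤ g → g ≤ n → ∃ λ i → h i ≡ g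
fill h pos bound h-inj g 1≤g g≤n =
  let i , fi≡g = injective⇒surjective f f-injective (fromPositive g 1≤g g≤n)
  in i , trans (sym (back i)) (trans (cong (suc ∘ toℕ) fi≡g) (suc-toℕ-fromPositive g 1≤g g≤n))
  where
    f : Fin _ → Fin _
    f i = fromPositive (h i) (pos i) (bound i)
    back : ∀ i → suc (toℕ (f i)) ≡ h i
    back i = suc-toℕ-fromPositive (h i) (pos i) (bound i)
    f-injective : Injective _≡_ _≡_ f
    f-injective {i} {j} fi≡fj = h-inj (trans (sym (back i)) (trans (cong (suc ∘ toℕ) fi≡fj) (back j)))

fill₂ : ∀ {n} (h : Fin n ⊎ Fin n → ℕ) → (∀ x → 1 ≤ h x) → (∀ x → h x ≤ n + n) →
        Injective _≡_ _≡_ h → ∀ g → 1 ≤ g → g ≤ n + n → ∃ λ x → h x ≡ g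
fill₂ {n} h pos bound h-inj g 1≤g g≤2n =
  let i , hi≡g = fill (h ∘ splitAt n) (pos ∘ splitAt n) (bound ∘ splitAt n) split-injective g 1≤g g≤2n
  in splitAt n i , hi≡g
  where
    split-injective : Injective _≡_ _≡_ (h ∘ splitAt n)
    split-injective {i} {j} eq = trans (sym (Finₚ.join-splitAt n n i))
                                  (trans (cong (join n n) (h-inj eq)) (Finₚ.join-splitAt n n j))

entries : ∀ {t} → Pairs t → Fin t ⊎ Fin t → ℕ
entries S (inj₁ i) = proj₁ (S i)
entries S (inj₂ i) = proj₂ (S i)

-- The entries of S form exactly the set G* = {1,…,2t}; this is the shape of
-- both halves of the definition of a starter.
FormsNonZero : (t : ℕ) → Pairs t → Set
FormsNonZero t S =
    ((i : Fin t) → NonZeroElt t (proj₁ (S i)) × NonZeroElt t (proj₂ (S i)))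
  × ((g : ℕ) → NonZeroElt t g → ∃[ i ] ((proj₁ (S i) ≡ g) ⊎ (proj₂ (S i) ≡ g)))

forms-nonzero : ∀ {t} (S : Pairs t) → (∀ x → NonZeroElt t (entries S x)) →
                Injective _≡_ _≡_ (entries S) → FormsNonZero t S
forms-nonzero {t} S in-G* distinct =
  (λ i → in-G* (inj₁ i) , in-G* (inj₂ i)) , covers
  where
    ≤t+t : ∀ {g} → g < ord t → g ≤ t + t
    ≤t+t {g} g<q = ≤-trans (≤-pred g<q) (≤-reflexive (cong (t +_) (+-identityʳ t)))
    covers : (g : ℕ) → NonZeroElt t g → ∃[ i ] ((proj₁ (S i) ≡ g) ⊎ (proj₂ (S i) ≡ g))
    covers g (1≤g , g<q)
      with fill₂ (entries S) (proj₁ ∘ in-G*) (≤t+t ∘ proj₂ ∘ in-G*) distinct g 1≤g (≤t+t g<q)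
    ... | inj₁ i , xᵢ≡g = i , inj₁ xᵢ≡g
    ... | inj₂ i , yᵢ≡g = i , inj₂ yᵢ≡g

differences : ∀ {t} → Pairs t → Pairs t
differences {t} S i = subMod t (proj₁ (S i)) (proj₂ (S i)) , subMod t (proj₂ (S i)) (proj₁ (S i))

starter-criterion : ∀ {t} (S : Pairs t) → FormsNonZero t S → FormsNonZero t (differences S) →
                    IsStarter t S
starter-criterion S (entries-in , entries-cover) (diffs-in , diffs-cover) =
  entries-in , entries-cover , diffs-in , diffs-cover

-- Skolem criterion: if every pair of S has an orientation whose length lies in
-- {1,…,t}, and distinct pairs get distinct lengths, then the lengths are a
-- permutation of {1,…,t} and listing the pairs by length shows S is Skolem.
skolem-criterion : ∀ {t} (S : Pairs t) (D : Fin t → ℕ) → (∀ k → 1 ≤ D k) → (∀ k → D k ≤ t) →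
                   Injective _≡_ _≡_ D → (∀ k → Oriented (S k) (D k)) → IsSkolem t S
skolem-criterion {t} S D pos bound D-inj oriented = π , listed
  where
    rank : Fin t → Fin t
    rank k = fromPositive (D k) (pos k) (bound k)
    rank-value : ∀ k → suc (toℕ (rank k)) ≡ D k
    rank-value k = suc-toℕ-fromPositive (D k) (pos k) (bound k)
    rank-injective : Injective _≡_ _≡_ rank
    rank-injective {k} {l} eq =
      D-inj (trans (sym (rank-value k)) (trans (cong (suc ∘ toℕ) eq) (rank-value l)))
    pairOfRank : Fin t → Fin t
    pairOfRank i = proj₁ (injective⇒surjective rank rank-injective i)
    rank-pairOfRank : ∀ i → rank (pairOfRank i) ≡ i
    rank-pairOfRank i = proj₂ (injective⇒surjective rank rank-injective i)
    π : Fin t ↔ Fin t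
    π = mk↔ₛ′ pairOfRank rank (λ k → rank-injective (rank-pairOfRank (rank k))) rank-pairOfRank
    listed : (i : Fin t) → ∃[ x ] ∃[ y ] ((S (pairOfRank i) ≈ᵤ (x , y)) × (x < y)
                                          × ((y ∸ x) % ord t ≡ suc (toℕ i) % ord t))
    listed i with oriented (pairOfRank i)
    ... | x , y , same , x<y , len =
      x , y , same , x<y ,
      cong (_% ord t) (trans len (trans (sym (rank-value (pairOfRank i)))
                                        (cong (suc ∘ toℕ) (rank-pairOfRank i))))

Fin-subsingleton : ∀ {n} → n ≤ 1 → (i j : Fin n) → i ≡ j
Fin-subsingleton {suc zero}    _         Fin.zero Fin.zero = refl
Fin-subsingleton {suc (suc _)} (s≤s ()) _        _

^-distribʳ-* : ∀ x y k → (x * y) ^ k ≡ x ^ k * y ^ k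
^-distribʳ-* x y zero    = refl
^-distribʳ-* x y (suc k) = trans (cong (x * y *_) (^-distribʳ-* x y k)) (regroup x y (x ^ k) (y ^ k))
  where
    regroup : ∀ a b c d → a * b * (c * d) ≡ a * c * (b * d)
    regroup = solve-∀

evenProduct : ℕ → ℕ → ℕ
evenProduct a zero    = 1
evenProduct a (suc n) = 2 * suc a * evenProduct (suc a) n

oddProduct : ℕ → ℕ
oddProduct zero    = 1
oddProduct (suc n) = suc (2 * n) * oddProduct n

evenProduct-factorial : ∀ a n → evenProduct a n * a ! ≡ 2 ^ n * (a + n) !
evenProduct-factorial a zero = cong (λ m → 1 * m !) (sym (+-identityʳ a))
evenProduct-factorial a (suc n) = begin
  2 * suc a * evenProduct (suc a) n * a !    ≡⟨ regroup (suc a) (evenProduct (suc a) n) (a !) ⟩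
  2 * (evenProduct (suc a) n * suc a !)      ≡⟨ cong (2 *_) (evenProduct-factorial (suc a) n) ⟩
  2 * (2 ^ n * (suc a + n) !)                ≡⟨ *-assoc 2 (2 ^ n) _ ⟨
  2 ^ suc n * (suc a + n) !                  ≡⟨ cong (λ m → 2 ^ suc n * m !) (+-suc a n) ⟨
  2 ^ suc n * (a + suc n) !                  ∎
  where
    open ≡-Reasoning
    regroup : ∀ x y z → 2 * x * y * z ≡ 2 * (y * (x * z))
    regroup = solve-∀

factorial-evenOdd : ∀ n → suc (2 * n) ! ≡ 2 ^ n * n ! * oddProduct (suc n)
factorial-evenOdd zero = refl
factorial-evenOdd (suc n) = begin
  suc (2 * suc n) !                                           ≡⟨ cong (λ m → suc m !) (*-suc 2 n) ⟩
  (3 + 2 * n) * ((2 + 2 * n) * suc (2 * n) !)                 ≡⟨ cong (λ m → (3 + 2 * n) * ((2 + 2 * n) * m)) (factorial-evenOdd n) ⟩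
  (3 + 2 * n) * ((2 + 2 * n) * (2 ^ n * n ! * oddProduct (suc n)))
                                                              ≡⟨ regroup n (2 ^ n) (n !) (oddProduct (suc n)) ⟩
  2 ^ suc n * suc n ! * oddProduct (suc (suc n))              ∎
  where
    open ≡-Reasoning
    regroup : ∀ n x y z → (3 + 2 * n) * ((2 + 2 * n) * (x * y * z))
                        ≡ 2 * x * (suc n * y) * (suc (2 * suc n) * z)
    regroup = solve-∀

-- Arithmetic of doubling in Z_(2t+1): for t < u ≤ 2t we have 2u = (2t+1) + w
-- with w < u, and the gap D = u − w equals 2t+1−u, which lies in {1,…,t}.
-- Writing u = (t+1) + e (so e < t) and t = (e+1) + d, these are w = 2e+1
-- and D = d+1, and all claims become polynomial identities.
double-wraps : ∀ {t u} → t < u → u < suc (2 * t) →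
  ∃₂ λ w D → (w + suc (2 * t) ≡ 2 * u) × (w + D ≡ u) × (1 ≤ D) × (D ≤ t) × (D + u ≡ suc (2 * t))
double-wraps {t} t<u u<q
  with e , refl ← m≤n⇒∃[o]m+o≡n t<u
  with d , refl ← m≤n⇒∃[o]m+o≡n (subst (e <_) (+-identityʳ t) (+-cancelˡ-< t e (t + 0) (≤-pred u<q)))
  = suc (2 * e) , suc d , wrap e d , gap e d , s≤s z≤n , s≤s (m≤n+m d e) , sum e d
  where
    wrap : ∀ e d → suc (2 * e) + suc (2 * (suc e + d)) ≡ 2 * (suc (suc e + d) + e)
    wrap = solve-∀
    gap : ∀ e d → suc (2 * e) + suc d ≡ suc (suc e + d) + e
    gap = solve-∀
    sum : ∀ e d → suc d + (suc (suc e + d) + e) ≡ suc (2 * (suc e + d))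
    sum = solve-∀

t≡4m+1 : ∀ t → ord t % 8 ≡ 3 → t ≡ suc (2 * (2 * (ord t / 8)))
t≡4m+1 t q%8≡3 = *-cancelˡ-≡ t _ 2 (suc-injective (begin
  suc (2 * t)                  ≡⟨ m≡m%n+[m/n]*n (ord t) 8 ⟩
  ord t % 8 + ord t / 8 * 8    ≡⟨ cong (_+ ord t / 8 * 8) q%8≡3 ⟩
  3 + ord t / 8 * 8            ≡⟨ regroup (ord t / 8) ⟩
  suc (2 * suc (2 * (2 * (ord t / 8)))) ∎))
  where
    open ≡-Reasoning
    regroup : ∀ m → 3 + m * 8 ≡ suc (2 * suc (2 * (2 * m)))
    regroup = solve-∀

-- (q+1)/2 = t+1, the inverse of 2 modulo q = 2t+1.
half≡suc : ∀ t → (ord t + 1) / 2 ≡ suc t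
half≡suc t = trans (cong (_/ 2) (+-comm (ord t) 1)) (trans (cong (_/ 2) (regroup t)) (m*n/n≡m (suc t) 2))
  where
    regroup : ∀ t → 1 + suc (2 * t) ≡ suc t * 2
    regroup = solve-∀

module Congruence (q : ℕ) .{{_ : NonZero q}} where

  infix 4 _≈_ _≉_
  record _≈_ (a b : ℕ) : Set where
    constructor mk≈
    field residue : a % q ≡ b % q
  open _≈_ public

  _≉_ : ℕ → ℕ → Set
  a ≉ b = ¬ (a ≈ b)

  ≈-isEquivalence : IsEquivalence _≈_
  ≈-isEquivalence = record
    { refl  = mk≈ refl
    ; sym   = λ { (mk≈ e) → mk≈ (sym e) }
    ; trans = λ { (mk≈ e) (mk≈ f) → mk≈ (trans e f) }
    }

  ≈-setoid : Setoid 0ℓ 0ℓ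
  ≈-setoid = record { isEquivalence = ≈-isEquivalence }

  open IsEquivalence ≈-isEquivalence public
    using () renaming (refl to ≈-refl; sym to ≈-sym; trans to ≈-trans; reflexive to ≈-reflexive)
  module ≈-Reasoning = SetoidReasoning ≈-setoid

  0<q : 0 < q
  0<q = >-nonZero⁻¹ q

  0%q≡0 : 0 % q ≡ 0
  0%q≡0 = m<n⇒m%n≡m 0<q

  %-≈ : ∀ a → a % q ≈ a
  %-≈ a = mk≈ (m%n%n≡m%n a q)

  q≈0 : q ≈ 0
  q≈0 = mk≈ (trans (n%n≡0 q) (sym 0%q≡0))

  ∣⇒≈0 : ∀ {a} → q ∣ a → a ≈ 0
  ∣⇒≈0 {a} q∣a = mk≈ (trans (n∣m⇒m%n≡0 a q q∣a) (sym 0%q≡0))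

  ≈0⇒∣ : ∀ {a} → a ≈ 0 → q ∣ a
  ≈0⇒∣ {a} (mk≈ e) = m%n≡0⇒n∣m a q (trans e 0%q≡0)

  +-cong : ∀ {a b c d} → a ≈ b → c ≈ d → a + c ≈ b + d
  +-cong {a} {b} {c} {d} (mk≈ e) (mk≈ f) = mk≈ (begin
    (a + c) % q           ≡⟨ %-distribˡ-+ a c q ⟩
    (a % q + c % q) % q   ≡⟨ cong₂ (λ x y → (x + y) % q) e f ⟩
    (b % q + d % q) % q   ≡⟨ %-distribˡ-+ b d q ⟨
    (b + d) % q           ∎)
    where open ≡-Reasoning

  *-cong : ∀ {a b c d} → a ≈ b → c ≈ d → a * c ≈ b * d
  *-cong {a} {b} {c} {d} (mk≈ e) (mk≈ f) = mk≈ (begin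
    (a * c) % q               ≡⟨ %-distribˡ-* a c q ⟩
    (a % q * (c % q)) % q     ≡⟨ cong₂ (λ x y → (x * y) % q) e f ⟩
    (b % q * (d % q)) % q     ≡⟨ %-distribˡ-* b d q ⟨
    (b * d) % q               ∎)
    where open ≡-Reasoning

  +-congˡ : ∀ {a b} c → a ≈ b → c + a ≈ c + b
  +-congˡ c = +-cong (≈-refl {c})

  +-congʳ : ∀ {a b} c → a ≈ b → a + c ≈ b + c
  +-congʳ c e = +-cong e (≈-refl {c})

  *-congˡ : ∀ {a b} c → a ≈ b → c * a ≈ c * b
  *-congˡ c = *-cong (≈-refl {c})

  *-congʳ : ∀ {a b} c → a ≈ b → a * c ≈ b * c
  *-congʳ c e = *-cong e (≈-refl {c})

  ^-congˡ : ∀ {a b} k → a ≈ b → a ^ k ≈ b ^ k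
  ^-congˡ zero    e = ≈-refl
  ^-congˡ (suc k) e = *-cong e (^-congˡ k e)

  ≈-small : ∀ {a b} → a < q → b < q → a ≈ b → a ≡ b
  ≈-small {a} {b} a<q b<q (mk≈ e) = trans (sym (m<n⇒m%n≡m a<q)) (trans e (m<n⇒m%n≡m b<q))

  small-nonzero : ∀ {a} → 1 ≤ a → a < q → a ≉ 0
  small-nonzero {a} 1≤a a<q a≈0 = <⇒≢ 1≤a (sym (≈-small a<q 0<q a≈0))

  ≉0⇒1≤ : ∀ {a} → a ≉ 0 → 1 ≤ a
  ≉0⇒1≤ a≉0 = n≢0⇒n>0 (λ a≡0 → a≉0 (≈-reflexive a≡0))

  +-inverse : ∀ c → c + (q ∸ c % q) ≈ 0
  +-inverse c = begin
    c + (q ∸ c % q)       ≈⟨ +-congʳ (q ∸ c % q) (%-≈ c) ⟨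
    c % q + (q ∸ c % q)   ≡⟨ m+[n∸m]≡n (m%n≤n c q) ⟩
    q                     ≈⟨ q≈0 ⟩
    0                     ∎
    where open ≈-Reasoning

  +-cancelʳ : ∀ {a b} c → a + c ≈ b + c → a ≈ b
  +-cancelʳ {a} {b} c e = begin
    a                     ≡⟨ +-identityʳ a ⟨
    a + 0                 ≈⟨ +-congˡ a (+-inverse c) ⟨
    a + (c + c')          ≡⟨ +-assoc a c c' ⟨
    a + c + c'            ≈⟨ +-congʳ c' e ⟩
    b + c + c'            ≡⟨ +-assoc b c c' ⟩
    b + (c + c')          ≈⟨ +-congˡ b (+-inverse c) ⟩
    b + 0                 ≡⟨ +-identityʳ b ⟩
    b                     ∎
    where
      open ≈-Reasoning
      c' = q ∸ c % q

  +-cancelˡ : ∀ {a b} c → c + a ≈ c + b → a ≈ b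
  +-cancelˡ {a} {b} c e =
    +-cancelʳ c (≈-trans (≈-reflexive (+-comm a c)) (≈-trans e (≈-reflexive (+-comm c b))))

module PrimeCongruence {q : ℕ} (q-prime : Prime q) where

  private instance
    q≢0 : NonZero q
    q≢0 = prime⇒nonZero q-prime

  open Congruence q public

  zero-product : ∀ a b → a * b ≈ 0 → a ≈ 0 ⊎ b ≈ 0
  zero-product a b ab≈0 with euclidsLemma a b q-prime (≈0⇒∣ ab≈0)
  ... | inj₁ q∣a = inj₁ (∣⇒≈0 q∣a)
  ... | inj₂ q∣b = inj₂ (∣⇒≈0 q∣b)

  *-nonzero : ∀ {a b} → a ≉ 0 → b ≉ 0 → a * b ≉ 0
  *-nonzero {a} {b} a≉0 b≉0 ab≈0 = [ a≉0 , b≉0 ]′ (zero-product a b ab≈0)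

  1≉0 : 1 ≉ 0
  1≉0 = small-nonzero ≤-refl (nonTrivial⇒n>1 q {{prime⇒nonTrivial q-prime}})

  ^-nonzero : ∀ {a} k → a ≉ 0 → a ^ k ≉ 0
  ^-nonzero zero    a≉0 = 1≉0
  ^-nonzero (suc k) a≉0 = *-nonzero a≉0 (^-nonzero k a≉0)

  annihilated : ∀ {c d} → c ≉ 0 → d < q → c * d ≈ 0 → d ≡ 0
  annihilated {c} {d} c≉0 d<q cd≈0 with zero-product c d cd≈0
  ... | inj₁ c≈0 = ⊥-elim (c≉0 c≈0)
  ... | inj₂ d≈0 = ≈-small d<q 0<q d≈0

  -- cancellation of a non-zero factor: write the larger residue as the
  -- smaller one plus d; then c·d ≈ 0 forces d = 0
  private
    cancel-ordered : ∀ {a b c} → c ≉ 0 → a % q ≤ b % q → c * a ≈ c * b → a ≈ b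
    cancel-ordered {a} {b} {c} c≉0 a'≤b' e = begin
      a              ≈⟨ %-≈ a ⟨
      a % q          ≡⟨ +-identityʳ (a % q) ⟨
      a % q + 0      ≡⟨ cong (a % q +_) d≡0 ⟨
      a % q + d      ≡⟨ m+[n∸m]≡n a'≤b' ⟩
      b % q          ≈⟨ %-≈ b ⟩
      b              ∎
      where
        open ≈-Reasoning
        d = b % q ∸ a % q
        cd≈0 : c * d ≈ 0
        cd≈0 = ≈-sym (+-cancelˡ (c * (a % q)) (begin
          c * (a % q) + 0       ≡⟨ +-identityʳ _ ⟩
          c * (a % q)           ≈⟨ *-congˡ c (%-≈ a) ⟩
          c * a                 ≈⟨ e ⟩
          c * b                 ≈⟨ *-congˡ c (%-≈ b) ⟨
          c * (b % q)           ≡⟨ cong (c *_) (m+[n∸m]≡n a'≤b') ⟨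
          c * (a % q + d)       ≡⟨ *-distribˡ-+ c (a % q) d ⟩
          c * (a % q) + c * d   ∎))
        d≡0 : d ≡ 0
        d≡0 = annihilated c≉0 (≤-<-trans (m∸n≤m (b % q) (a % q)) (m%n<n b q)) cd≈0

  *-cancelˡ : ∀ {a b c} → c ≉ 0 → c * a ≈ c * b → a ≈ b
  *-cancelˡ {a} {b} c≉0 e with ≤-total (a % q) (b % q)
  ... | inj₁ a'≤b' = cancel-ordered c≉0 a'≤b' e
  ... | inj₂ b'≤a' = ≈-sym (cancel-ordered c≉0 b'≤a' (≈-sym e))

module OddPrime (t : ℕ) (q-prime : Prime (ord t)) where

  open PrimeCongruence q-prime public

  1≤t : 1 ≤ t
  1≤t = positive t (nonTrivial⇒n>1 (ord t) {{prime⇒nonTrivial q-prime}})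
    where
      positive : ∀ t → 1 < suc (2 * t) → 1 ≤ t
      positive zero    (s≤s ())
      positive (suc t) _ = s≤s z≤n

  t<q : t < ord t
  t<q = s≤s (m≤m+n t (t + 0))

  inG* : ∀ {z} → z ≉ 0 → z < ord t → NonZeroElt t z
  inG* z≉0 z<q = ≉0⇒1≤ z≉0 , z<q

  -- N = 2t represents −1
  N : ℕ
  N = 2 * t

  negation : ∀ {a b} → a + b ≈ 0 → a ≈ N * b
  negation {a} {b} a+b≈0 = +-cancelʳ b (begin
    a + b          ≈⟨ a+b≈0 ⟩
    0              ≈⟨ *-congʳ b q≈0 ⟨
    ord t * b      ≡⟨ +-comm b (N * b) ⟩
    N * b + b      ∎)
    where open ≈-Reasoning

  N*N≈1 : N * N ≈ 1
  N*N≈1 = ≈-sym (negation q≈0)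

  N^odd : ∀ k → N ^ suc (2 * k) ≈ N
  N^odd k = begin
    N * N ^ (2 * k)       ≡⟨ cong (N *_) (^-*-assoc N 2 k) ⟨
    N * (N * (N * 1)) ^ k ≈⟨ *-congˡ N (^-congˡ k (≈-trans (≈-reflexive (cong (N *_) (*-identityʳ N))) N*N≈1)) ⟩
    N * 1 ^ k             ≡⟨ cong (N *_) (^-zeroˡ k) ⟩
    N * 1                 ≡⟨ *-identityʳ N ⟩
    N                     ∎
    where open ≈-Reasoning

  2≤N : 2 ≤ N
  2≤N = +-mono-≤ 1≤t (≤-trans 1≤t (m≤m+n t 0))

  N≉0 : N ≉ 0
  N≉0 = small-nonzero (≤-trans (s≤s z≤n) 2≤N) ≤-refl

  N≉1 : N ≉ 1
  N≉1 N≈1 = <⇒≢ 2≤N (sym (≈-small ≤-refl (s≤s (≤-trans (s≤s z≤n) 2≤N)) N≈1))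

  subMod-bound : ∀ x y → subMod t x y < ord t
  subMod-bound x y = m%n<n (x + (ord t ∸ y % ord t)) (ord t)

  subMod-≈ : ∀ x y → subMod t x y ≈ x + N * y
  subMod-≈ x y = ≈-trans (%-≈ _) (+-congˡ x (negation (≈-trans (≈-reflexive (+-comm _ y)) (+-inverse y))))

  square : Fin t → ℕ
  square i = suc (toℕ i) * suc (toℕ i)

  -- They are pairwise incongruent: if z = y + d then z² − y² = (y+z)·d,
  -- and 0 < y+z < q.
  private
    squares-ordered : ∀ {y z} → 1 ≤ y → y ≤ z → z ≤ t → y * y ≈ z * z → y ≡ z
    squares-ordered {y} {z} 1≤y y≤z z≤t y²≈z² = begin
      y          ≡⟨ +-identityʳ y ⟨
      y + 0      ≡⟨ cong (y +_) d≡0 ⟨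
      y + d      ≡⟨ m+[n∸m]≡n y≤z ⟩
      z          ∎
      where
        open ≡-Reasoning
        d = z ∸ y
        expand : ∀ y d → y * y + (y + (y + d)) * d ≡ (y + d) * (y + d)
        expand = solve-∀
        y+z<q : y + z < ord t
        y+z<q = s≤s (+-mono-≤ (≤-trans y≤z z≤t) (≤-trans z≤t (m≤m+n t 0)))
        z²-y² : y * y + (y + z) * d ≡ z * z
        z²-y² = subst (λ w → y * y + (y + w) * d ≡ w * w) (m+[n∸m]≡n y≤z) (expand y d)
        [y+z]d≈0 : (y + z) * d ≈ 0
        [y+z]d≈0 = ≈-sym (+-cancelˡ (y * y) (≈-trans (≈-reflexive (+-identityʳ (y * y)))
                                              (≈-trans y²≈z² (≈-reflexive (sym z²-y²)))))
        d≡0 : d ≡ 0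
        d≡0 = annihilated (small-nonzero (≤-trans 1≤y (m≤m+n y z)) y+z<q)
                          (≤-<-trans (m∸n≤m z y) (≤-<-trans z≤t t<q)) [y+z]d≈0

  square-injective : ∀ i j → square i ≈ square j → i ≡ j
  square-injective i j e with ≤-total (toℕ i) (toℕ j)
  ... | inj₁ i≤j = Finₚ.toℕ-injective (suc-injective
                     (squares-ordered (s≤s z≤n) (s≤s i≤j) (Finₚ.toℕ<n j) e))
  ... | inj₂ j≤i = Finₚ.toℕ-injective (suc-injective
                     (sym (squares-ordered (s≤s z≤n) (s≤s j≤i) (Finₚ.toℕ<n i) (≈-sym e))))

  -- Every non-zero square is among them: of the residues r and q − r ≈ −r of
  -- u, one lies in {1,…,t}.
  square-root : ∀ u → u ≉ 0 → ∃ λ i → square i ≈ u * u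
  square-root u u≉0 with ≉0⇒1≤ (λ r≈0 → u≉0 (≈-trans (≈-sym (%-≈ u)) r≈0)) | u % ord t ≤? t
  ... | 1≤r | yes r≤t =
    fromPositive r 1≤r r≤t , ≈-trans (≈-reflexive (cong (λ y → y * y) (suc-toℕ-fromPositive r 1≤r r≤t)))
                                     (*-cong (%-≈ u) (%-≈ u))
    where r = u % ord t
  ... | 1≤r | no r≰t =
    fromPositive v 1≤v v≤t , (begin
      square (fromPositive v 1≤v v≤t)   ≡⟨ cong (λ y → y * y) (suc-toℕ-fromPositive v 1≤v v≤t) ⟩
      v * v                             ≈⟨ *-cong v≈-r v≈-r ⟩
      N * r * (N * r)                   ≡⟨ regroup N r ⟩
      N * N * (r * r)                   ≈⟨ *-congʳ (r * r) N*N≈1 ⟩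
      1 * (r * r)                       ≡⟨ *-identityˡ (r * r) ⟩
      r * r                             ≈⟨ *-cong (%-≈ u) (%-≈ u) ⟩
      u * u                             ∎)
    where
      open ≈-Reasoning
      r = u % ord t
      v = ord t ∸ r
      r<q : r < ord t
      r<q = m%n<n u (ord t)
      1≤v : 1 ≤ v
      1≤v = m<n⇒0<n∸m r<q
      v≤t : v ≤ t
      v≤t = ≤-trans (∸-monoʳ-≤ (ord t) (≰⇒> r≰t))
                    (≤-reflexive (trans (m+n∸m≡n t (t + 0)) (+-identityʳ t)))
      v≈-r : v ≈ N * r
      v≈-r = negation (≈-trans (≈-reflexive (m∸n+n≡m (<⇒≤ r<q))) q≈0)
      regroup : ∀ a b → a * b * (a * b) ≡ a * a * (b * b)
      regroup = solve-∀

  factorial-nonzero : ∀ k → k < ord t → k ! ≉ 0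
  factorial-nonzero zero    _   = 1≉0
  factorial-nonzero (suc k) k<q =
    *-nonzero (small-nonzero (s≤s z≤n) k<q) (factorial-nonzero k (<-trans (n<1+n k) k<q))

  -- When q = 2(a+n)+1, each even factor 2(a+j) is ≡ −(q − 2(a+j)), an odd
  -- number below 2n; so the evens above 2a mirror the first n odds.
  evenProduct-mirror : ∀ a n → suc (2 * (a + n)) ≡ ord t → evenProduct a n ≈ N ^ n * oddProduct n
  evenProduct-mirror a zero    _   = ≈-refl
  evenProduct-mirror a (suc n) q≡ = begin
    2 * suc a * evenProduct (suc a) n              ≈⟨ *-cong 2[a+1]≈-[2n+1] (evenProduct-mirror (suc a) n q≡′) ⟩
    N * suc (2 * n) * (N ^ n * oddProduct n)       ≡⟨ regroup N (suc (2 * n)) (N ^ n) (oddProduct n) ⟩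
    N ^ suc n * oddProduct (suc n)                 ∎
    where
      open ≈-Reasoning
      q≡′ : suc (2 * (suc a + n)) ≡ ord t
      q≡′ = trans (cong (λ m → suc (2 * m)) (sym (+-suc a n))) q≡
      sum : ∀ a n → 2 * suc a + suc (2 * n) ≡ suc (2 * (a + suc n))
      sum = solve-∀
      2[a+1]≈-[2n+1] : 2 * suc a ≈ N * suc (2 * n)
      2[a+1]≈-[2n+1] = negation (≈-trans (≈-reflexive (trans (sum a n) q≡)) q≈0)
      regroup : ∀ x y z w → x * y * (z * w) ≡ x * z * (y * w)
      regroup = solve-∀

  -- Both 2^t·t! = 2^a·(evens 2(a+1)…2(2a+1))·a! and t! = 2^a·a!·(odds 1…2a+1)
  -- are compared through the mirror lemma, and t! is cancelled.
  two^t : ∀ a → t ≡ suc (2 * a) → 2 ^ t ≈ N ^ suc a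
  two^t a t≡ = subst (λ s → 2 ^ s ≈ N ^ suc a) (sym t≡) (*-cancelˡ t!≉0 (begin
    T * 2 ^ t′                                          ≡⟨ cong (λ m → T * 2 ^ m) t′≡ ⟩
    T * 2 ^ (a + suc a)                                 ≡⟨ cong (T *_) (^-distribˡ-+-* 2 a (suc a)) ⟩
    T * (2 ^ a * 2 ^ suc a)                             ≡⟨ regroup₁ T (2 ^ a) (2 ^ suc a) ⟩
    2 ^ a * (2 ^ suc a * T)                             ≡⟨ cong (λ m → 2 ^ a * (2 ^ suc a * m !)) t′≡ ⟩
    2 ^ a * (2 ^ suc a * (a + suc a) !)                 ≡⟨ cong (2 ^ a *_) (evenProduct-factorial a (suc a)) ⟨
    2 ^ a * (evenProduct a (suc a) * a !)               ≈⟨ *-congˡ (2 ^ a) (*-congʳ (a !) (evenProduct-mirror a (suc a) q≡)) ⟩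
    2 ^ a * (N ^ suc a * oddProduct (suc a) * a !)      ≡⟨ regroup₂ (2 ^ a) (N ^ suc a) (oddProduct (suc a)) (a !) ⟩
    2 ^ a * a ! * oddProduct (suc a) * N ^ suc a        ≡⟨ cong (_* N ^ suc a) (factorial-evenOdd a) ⟨
    T * N ^ suc a                                       ∎))
    where
      open ≈-Reasoning
      t′ = suc (2 * a)
      T = t′ !
      t′≡ : t′ ≡ a + suc a
      t′≡ = trans (cong suc (cong (a +_) (+-identityʳ a))) (sym (+-suc a a))
      q≡ : suc (2 * (a + suc a)) ≡ ord t
      q≡ = cong (λ m → suc (2 * m)) (trans (sym t′≡) (sym t≡))
      t!≉0 : T ≉ 0
      t!≉0 = factorial-nonzero t′ (subst (_< ord t) t≡ t<q)
      regroup₁ : ∀ x y z → x * (y * z) ≡ y * (z * x)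
      regroup₁ = solve-∀
      regroup₂ : ∀ x y z w → x * (y * z * w) ≡ x * w * z * y
      regroup₂ = solve-∀

  -- The pair {u, 2u}, u ∈ G*, has a Skolem orientation whose length D lies in
  -- {1,…,t}: D = u if 2u < q, and D = q − u ≡ −u if 2u wraps around q.
  doubling-length : ∀ {u v} → 1 ≤ u → u < ord t → v < ord t → v ≈ 2 * u →
                    Σ ℕ λ D → 1 ≤ D × D ≤ t × (D ≈ u ⊎ D ≈ N * u) × Oriented (u , v) D
  doubling-length {u} {v} 1≤u u<q v<q v≈2u with u ≤? t
  ... | yes u≤t = u , 1≤u , u≤t , inj₁ ≈-refl , u , v , inj₁ (refl , refl) , u<v , v∸u≡u
    where
      v≡u+u : v ≡ u + u
      v≡u+u = trans (≈-small v<q (s≤s (*-monoʳ-≤ 2 u≤t)) v≈2u) (cong (u +_) (+-identityʳ u))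
      u<v : u < v
      u<v = subst (u <_) (sym v≡u+u) (m<m+n u 1≤u)
      v∸u≡u : v ∸ u ≡ u
      v∸u≡u = trans (cong (_∸ u) v≡u+u) (m+n∸m≡n u u)
  ... | no u≰t
    with w , D , wrap , gap , 1≤D , D≤t , D+u≡q ← double-wraps (≰⇒> u≰t) u<q
    = D , 1≤D , D≤t , inj₂ (negation (≈-trans (≈-reflexive D+u≡q) q≈0)) ,
      v , u , inj₂ (refl , refl) , v<u , u∸v≡D
    where
      w<u : w < u
      w<u = subst (w <_) gap (m<m+n w 1≤D)
      v≡w : v ≡ w
      v≡w = ≈-small v<q (<-trans w<u u<q) (begin
        v              ≈⟨ v≈2u ⟩
        2 * u          ≡⟨ wrap ⟨
        w + ord t      ≈⟨ +-congˡ w q≈0 ⟩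
        w + 0          ≡⟨ +-identityʳ w ⟩
        w              ∎)
        where open ≈-Reasoning
      v<u : v < u
      v<u = subst (_< u) (sym v≡w) w<u
      u∸v≡D : u ∸ v ≡ D
      u∸v≡D = trans (cong₂ _∸_ (sym gap) v≡w) (m+n∸m≡n w D)

  module Generator (α : ℕ) (generator : IsQRGenerator t α) where

    IsPow : ℕ → Set
    IsPow x = ∃[ k ] (α ^ k ≈ x)

    -- quadratic non-residues: non-zero classes outside ⟨α⟩ = QR(q)
    NonResidue : ℕ → Set
    NonResidue x = x ≉ 0 × ¬ IsPow x

    α≉0 : α ≉ 0
    α≉0 (mk≈ α%q≡0) = proj₁ (proj₁ generator) (trans α%q≡0 0%q≡0)

    square-isPow : ∀ i → IsPow (square i)
    square-isPow i =
      let k , αᵏ≡i² = proj₂ generator (square i) (nonzero , suc (toℕ i) , refl) in k , mk≈ αᵏ≡i²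
      where
        root≉0 : suc (toℕ i) ≉ 0
        root≉0 = small-nonzero (s≤s z≤n) (≤-<-trans (Finₚ.toℕ<n i) t<q)
        nonzero : square i % ord t ≢ 0
        nonzero i²%q≡0 = *-nonzero root≉0 root≉0 (mk≈ (trans i²%q≡0 (sym 0%q≡0)))

    pow-isSquare : ∀ k → ∃ λ i → square i ≈ α ^ k
    pow-isSquare k =
      let i , sq≈ = square-root (w ^ k) (^-nonzero k w≉0)
      in i , ≈-trans sq≈ (≈-trans (≈-reflexive (sym (^-distribʳ-* w w k))) (^-congˡ k w²≈α))
      where
        w = proj₁ (proj₂ (proj₁ generator))
        w²≈α : w * w ≈ α
        w²≈α = mk≈ (proj₂ (proj₂ (proj₁ generator)))
        w≉0 : w ≉ 0
        w≉0 w≈0 = α≉0 (≈-trans (≈-sym w²≈α) (*-congʳ w w≈0))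

    pow-gap : ∀ {a b} → a ≤ b → α ^ a ≈ α ^ b → α ^ (b ∸ a) ≈ 1
    pow-gap {a} {b} a≤b αᵃ≈αᵇ = ≈-sym (*-cancelˡ (^-nonzero a α≉0) (begin
      α ^ a * 1              ≡⟨ *-identityʳ (α ^ a) ⟩
      α ^ a                  ≈⟨ αᵃ≈αᵇ ⟩
      α ^ b                  ≡⟨ cong (α ^_) (m+[n∸m]≡n a≤b) ⟨
      α ^ (a + (b ∸ a))      ≡⟨ ^-distribˡ-+-* α a (b ∸ a) ⟩
      α ^ a * α ^ (b ∸ a)    ∎))
      where open ≈-Reasoning

    pow-mod : ∀ d .{{_ : NonZero d}} k → α ^ d ≈ 1 → α ^ k ≈ α ^ (k % d)
    pow-mod d k αᵈ≈1 = begin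
      α ^ k                              ≡⟨ cong (α ^_) (m≡m%n+[m/n]*n k d) ⟩
      α ^ (k % d + k / d * d)            ≡⟨ ^-distribˡ-+-* α (k % d) (k / d * d) ⟩
      α ^ (k % d) * α ^ (k / d * d)      ≡⟨ cong (λ e → α ^ (k % d) * α ^ e) (*-comm (k / d) d) ⟩
      α ^ (k % d) * α ^ (d * (k / d))    ≡⟨ cong (α ^ (k % d) *_) (^-*-assoc α d (k / d)) ⟨
      α ^ (k % d) * (α ^ d) ^ (k / d)    ≈⟨ *-congˡ (α ^ (k % d)) (^-congˡ (k / d) αᵈ≈1) ⟩
      α ^ (k % d) * 1 ^ (k / d)          ≡⟨ cong (α ^ (k % d) *_) (^-zeroˡ (k / d)) ⟩
      α ^ (k % d) * 1                    ≡⟨ *-identityʳ (α ^ (k % d)) ⟩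
      α ^ (k % d)                        ∎
      where open ≈-Reasoning

    -- α has order at least t: the t distinct squares 1², …, t² are powers of
    -- α, and reducing their exponents modulo an order d stays injective
    order-≥ : ∀ d → 1 ≤ d → α ^ d ≈ 1 → t ≤ d
    order-≥ d@(suc _) _ αᵈ≈1 = Finₚ.injective⇒≤ log-injective
      where
        exponent : Fin t → ℕ
        exponent i = proj₁ (square-isPow i)
        log : Fin t → Fin d
        log i = fromℕ< (m%n<n (exponent i) d)
        log-spec : ∀ i → α ^ toℕ (log i) ≈ square i
        log-spec i = begin
          α ^ toℕ (log i)         ≡⟨ cong (α ^_) (Finₚ.toℕ-fromℕ< (m%n<n (exponent i) d)) ⟩
          α ^ (exponent i % d)    ≈⟨ pow-mod d (exponent i) αᵈ≈1 ⟨
          α ^ exponent i          ≈⟨ proj₂ (square-isPow i) ⟩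
          square i                ∎
          where open ≈-Reasoning
        log-injective : Injective _≡_ _≡_ log
        log-injective {i} {j} same = square-injective i j
          (≈-trans (≈-sym (log-spec i)) (≈-trans (≈-reflexive (cong (λ l → α ^ toℕ l) same)) (log-spec j)))

    -- Conversely α^t ≈ 1: the t+1 powers α⁰, …, α^t are squares of 1, …, t,
    -- so two of them coincide; their gap is a period of length ≤ t, hence t.
    α^t≈1 : α ^ t ≈ 1
    α^t≈1 with i , j , i<j , same-root ← Finₚ.pigeonhole (n<1+n t) (proj₁ ∘ pow-isSquare ∘ toℕ)
      = subst (λ d → α ^ d ≈ 1) (≤-antisym d≤t (order-≥ d (m<n⇒0<n∸m i<j) αᵈ≈1)) αᵈ≈1
      where
        d = toℕ j ∸ toℕ i
        d≤t : d ≤ t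
        d≤t = ≤-trans (m∸n≤m (toℕ j) (toℕ i)) (≤-pred (Finₚ.toℕ<n j))
        αᵈ≈1 : α ^ d ≈ 1
        αᵈ≈1 = pow-gap (<⇒≤ i<j) (≈-trans (≈-sym (proj₂ (pow-isSquare (toℕ i))))
                         (≈-trans (≈-reflexive (cong square same-root)) (proj₂ (pow-isSquare (toℕ j)))))

    α^[bt]≈1 : ∀ b → α ^ (b * t) ≈ 1
    α^[bt]≈1 b = begin
      α ^ (b * t)     ≡⟨ cong (α ^_) (*-comm b t) ⟩
      α ^ (t * b)     ≡⟨ ^-*-assoc α t b ⟨
      (α ^ t) ^ b     ≈⟨ ^-congˡ b α^t≈1 ⟩
      1 ^ b           ≡⟨ ^-zeroˡ b ⟩
      1               ∎
      where open ≈-Reasoning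

    no-short-period : ∀ {a b} → 1 ≤ a → a < b → b ≤ t → α ^ a ≈ α ^ b → ⊥
    no-short-period {a} {b} 1≤a a<b b≤t αᵃ≈αᵇ =
      <⇒≱ d<t (order-≥ d (m<n⇒0<n∸m a<b) (pow-gap (<⇒≤ a<b) αᵃ≈αᵇ))
      where
        d = b ∸ a
        d<t : d < t
        d<t = <-≤-trans (subst (d <_) (m+[n∸m]≡n (<⇒≤ a<b)) (m<n+m d 1≤a)) b≤t

    pow-injective : ∀ i j → α ^ suc (toℕ i) ≈ α ^ suc (toℕ j) → i ≡ j
    pow-injective i j e with <-cmp (toℕ i) (toℕ j)
    ... | tri< i<j _ _ = ⊥-elim (no-short-period (s≤s z≤n) (s≤s i<j) (Finₚ.toℕ<n j) e)
    ... | tri≈ _ i≡j _ = Finₚ.toℕ-injective i≡j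
    ... | tri> _ _ j<i = ⊥-elim (no-short-period (s≤s z≤n) (s≤s j<i) (Finₚ.toℕ<n i) (≈-sym e))

    -- ⟨α⟩ is closed under division: α^(t−1) inverts α, so c·α^b ≈ α^a
    -- gives c ≈ α^(a + b(t−1))
    pow-quotient : ∀ {c} a b → c * α ^ b ≈ α ^ a → IsPow c
    pow-quotient {c} a b e = a + b * pred t , ≈-sym (begin
      c                                   ≡⟨ *-identityʳ c ⟨
      c * 1                               ≈⟨ *-congˡ c (α^[bt]≈1 b) ⟨
      c * α ^ (b * t)                     ≡⟨ cong (λ n → c * α ^ n) b*t≡ ⟩
      c * α ^ (b + b * pred t)            ≡⟨ cong (c *_) (^-distribˡ-+-* α b (b * pred t)) ⟩
      c * (α ^ b * α ^ (b * pred t))      ≡⟨ *-assoc c (α ^ b) _ ⟨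
      c * α ^ b * α ^ (b * pred t)        ≈⟨ *-congʳ (α ^ (b * pred t)) e ⟩
      α ^ a * α ^ (b * pred t)            ≡⟨ ^-distribˡ-+-* α a (b * pred t) ⟨
      α ^ (a + b * pred t)                ∎)
      where
        open ≈-Reasoning
        b*t≡ : b * t ≡ b + b * pred t
        b*t≡ = trans (cong (b *_) (sym (suc-pred t {{>-nonZero 1≤t}}))) (*-suc b (pred t))

    pow^t≈1 : ∀ {x} → IsPow x → x ^ t ≈ 1
    pow^t≈1 {x} (k , αᵏ≈x) = begin
      x ^ t          ≈⟨ ^-congˡ t αᵏ≈x ⟨
      (α ^ k) ^ t    ≡⟨ ^-*-assoc α k t ⟩
      α ^ (k * t)    ≈⟨ α^[bt]≈1 k ⟩
      1              ∎
      where open ≈-Reasoning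

    nonResidue-by-power : ∀ {x} → x ≉ 0 → x ^ t ≈ N → NonResidue x
    nonResidue-by-power x≉0 xᵗ≈N = x≉0 , λ x∈⟨α⟩ → N≉1 (≈-trans (≈-sym xᵗ≈N) (pow^t≈1 x∈⟨α⟩))

    A : Fin t → ℕ
    A k = α ^ suc (toℕ k)

    A≉0 : ∀ k → A k ≉ 0
    A≉0 k = ^-nonzero (suc (toℕ k)) α≉0

    coset : ℕ → Fin t ⊎ Fin t → ℕ
    coset ρ (inj₁ k) = A k
    coset ρ (inj₂ k) = ρ * A k

    index : Fin t ⊎ Fin t → Fin t
    index = [ id , id ]′

    coset-nonzero : ∀ {ρ} → ρ ≉ 0 → ∀ x → coset ρ x ≉ 0
    coset-nonzero ρ≉0 (inj₁ k) = A≉0 k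
    coset-nonzero ρ≉0 (inj₂ k) = *-nonzero ρ≉0 (A≉0 k)

    -- for a non-residue ρ, ⟨α⟩ and ρ⟨α⟩ are disjoint, so the 2t numbers are distinct
    coset-injective : ∀ {ρ} → NonResidue ρ → ∀ x y → coset ρ x ≈ coset ρ y → x ≡ y
    coset-injective _          (inj₁ k) (inj₁ l) e = cong inj₁ (pow-injective k l e)
    coset-injective (ρ≉0 , _)  (inj₂ k) (inj₂ l) e = cong inj₂ (pow-injective k l (*-cancelˡ ρ≉0 e))
    coset-injective (_ , ρ∉)   (inj₁ k) (inj₂ l) e = ⊥-elim (ρ∉ (pow-quotient (suc (toℕ k)) (suc (toℕ l)) (≈-sym e)))
    coset-injective (_ , ρ∉)   (inj₂ k) (inj₁ l) e = ⊥-elim (ρ∉ (pow-quotient (suc (toℕ l)) (suc (toℕ k)) e))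

    scaled-coset-injective : ∀ {c ρ} → c ≉ 0 → NonResidue ρ → ∀ x y →
                             c * coset ρ x ≈ c * coset ρ y → x ≡ y
    scaled-coset-injective c≉0 ρ-nonres x y = coset-injective ρ-nonres x y ∘ *-cancelˡ c≉0

    cosets-formNonZero : ∀ {c ρ} (P : Pairs t) → c ≉ 0 → NonResidue ρ →
                         (∀ x → entries P x < ord t) → (∀ x → entries P x ≈ c * coset ρ x) →
                         FormsNonZero t P
    cosets-formNonZero P c≉0 ρ-nonres bound ≈coset = forms-nonzero P in-G* distinct
      where
        in-G* : ∀ x → NonZeroElt t (entries P x)
        in-G* x = inG* (λ Px≈0 → *-nonzero c≉0 (coset-nonzero (proj₁ ρ-nonres) x)
                                   (≈-trans (≈-sym (≈coset x)) Px≈0)) (bound x)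
        distinct : Injective _≡_ _≡_ (entries P)
        distinct {x} {y} Px≡Py = scaled-coset-injective c≉0 ρ-nonres x y
          (≈-trans (≈-sym (≈coset x)) (≈-trans (≈-reflexive Px≡Py) (≈coset y)))

    SignedLength : ℕ → Fin t → ℕ → Set
    SignedLength c k D = ∃ λ x → index x ≡ k × D ≈ c * coset N x

    -- as −1 is a non-residue, a signed length determines k
    signedLength-injective : ∀ {c k l D} → c ≉ 0 → NonResidue N →
                             SignedLength c k D → SignedLength c l D → k ≡ l
    signedLength-injective c≉0 N-nonres (x , refl , D≈cx) (y , refl , D≈cy) =
      cong index (scaled-coset-injective c≉0 N-nonres x y (≈-trans (≈-sym D≈cx) D≈cy))

    record SignedOrientation (c : ℕ) (k : Fin t) (p : ℕ × ℕ) : Set where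
      constructor signedOrientation
      field
        length   : ℕ
        1≤length : 1 ≤ length
        length≤t : length ≤ t
        signed   : SignedLength c k length
        oriented : Oriented p length

    swapped : ∀ {c k u v} → SignedOrientation c k (u , v) → SignedOrientation c k (v , u)
    swapped (signedOrientation D 1≤D D≤t signed oriented) =
      signedOrientation D 1≤D D≤t signed (oriented-swap oriented)

    skolem-by-signedLengths : ∀ {c} (P : Pairs t) → c ≉ 0 → NonResidue N →
                              (∀ k → SignedOrientation c k (P k)) → IsSkolem t P
    skolem-by-signedLengths {c} P c≉0 N-nonres so =
      skolem-criterion P (length ∘ so) (1≤length ∘ so) (length≤t ∘ so) length-injective (oriented ∘ so)
      where
        open SignedOrientation
        length-injective : Injective _≡_ _≡_ (length ∘ so)
        length-injective {k} {l} same = signedLength-injective c≉0 N-nonres (signed (so k))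
                                          (subst (SignedLength c l) (sym same) (signed (so l)))

    doubled-length : ∀ {c k u v} → c ≉ 0 → u < ord t → v < ord t → u ≈ c * A k → v ≈ 2 * u →
                     SignedOrientation c k (u , v)
    doubled-length {c} {k} c≉0 u<q v<q u≈cA v≈2u
      with doubling-length (≉0⇒1≤ (λ u≈0 → *-nonzero c≉0 (A≉0 k) (≈-trans (≈-sym u≈cA) u≈0)))
                           u<q v<q v≈2u
    ... | D , 1≤D , D≤t , inj₁ D≈u , oriented =
      signedOrientation D 1≤D D≤t (inj₁ k , refl , ≈-trans D≈u u≈cA) oriented
    ... | D , 1≤D , D≤t , inj₂ D≈-u , oriented =
      signedOrientation D 1≤D D≤t (inj₂ k , refl , D≈-cA) oriented
      where
        x*[y*z]≡y*[x*z] : ∀ x y z → x * (y * z) ≡ y * (x * z)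
        x*[y*z]≡y*[x*z] = solve-∀
        D≈-cA : D ≈ c * (N * A k)
        D≈-cA = ≈-trans D≈-u (≈-trans (*-congˡ N u≈cA) (≈-reflexive (x*[y*z]≡y*[x*z] N c (A k))))

    module Family (β : ℕ) where

      S : Pairs t
      S = Sβ t α β

      entries-≈ : ∀ x → entries S x ≈ 1 * coset β x
      entries-≈ (inj₁ k) = ≈-trans (%-≈ (A k)) (≈-reflexive (sym (*-identityˡ (A k))))
      entries-≈ (inj₂ k) = ≈-trans (%-≈ (β * A k)) (≈-reflexive (sym (*-identityˡ (β * A k))))

      entries-bound : ∀ x → entries S x < ord t
      entries-bound (inj₁ k) = m%n<n (A k) (ord t)
      entries-bound (inj₂ k) = m%n<n (β * A k) (ord t)

      -- δ = 1 − β; the differences of the k-th pair are δα^k and −δα^k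
      δ : ℕ
      δ = 1 + N * β

      δ≉0 : NonResidue β → δ ≉ 0
      δ≉0 (_ , β∉⟨α⟩) δ≈0 = β∉⟨α⟩ (0 , ≈-sym (begin
        β               ≡⟨ *-identityˡ β ⟨
        1 * β           ≈⟨ *-congʳ β N*N≈1 ⟨
        N * N * β       ≡⟨ *-assoc N N β ⟩
        N * (N * β)     ≈⟨ negation δ≈0 ⟨
        1               ∎))
        where open ≈-Reasoning

      differences-≈ : ∀ x → entries (differences S) x ≈ δ * coset N x
      differences-≈ (inj₁ k) = begin
        subMod t (A k % ord t) ((β * A k) % ord t)     ≈⟨ subMod-≈ _ _ ⟩
        A k % ord t + N * ((β * A k) % ord t)          ≈⟨ +-cong (%-≈ (A k)) (*-congˡ N (%-≈ (β * A k))) ⟩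
        A k + N * (β * A k)                            ≡⟨ regroup N β (A k) ⟩
        δ * A k                                        ∎
        where
          open ≈-Reasoning
          regroup : ∀ n b a → a + n * (b * a) ≡ (1 + n * b) * a
          regroup = solve-∀
      differences-≈ (inj₂ k) = begin
        subMod t ((β * A k) % ord t) (A k % ord t)     ≈⟨ subMod-≈ _ _ ⟩
        (β * A k) % ord t + N * (A k % ord t)          ≈⟨ +-cong (%-≈ (β * A k)) (*-congˡ N (%-≈ (A k))) ⟩
        β * A k + N * A k                              ≡⟨ regroup₁ (β * A k) (N * A k) ⟩
        N * A k + 1 * (β * A k)                        ≈⟨ +-congˡ (N * A k) (*-congʳ (β * A k) N*N≈1) ⟨
        N * A k + N * N * (β * A k)                    ≡⟨ regroup₂ N β (A k) ⟩
        δ * (N * A k)                                  ∎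
        where
          open ≈-Reasoning
          regroup₁ : ∀ x y → x + y ≡ y + 1 * x
          regroup₁ = solve-∀
          regroup₂ : ∀ n b a → n * a + n * n * (b * a) ≡ (1 + n * b) * (n * a)
          regroup₂ = solve-∀

      differences-bound : ∀ x → entries (differences S) x < ord t
      differences-bound (inj₁ k) = subMod-bound (A k % ord t) ((β * A k) % ord t)
      differences-bound (inj₂ k) = subMod-bound ((β * A k) % ord t) (A k % ord t)

      starter : NonResidue β → NonResidue N → IsStarter t S
      starter β-nonres N-nonres = starter-criterion S
        (cosets-formNonZero S 1≉0 β-nonres entries-bound entries-≈)
        (cosets-formNonZero (differences S) (δ≉0 β-nonres) N-nonres differences-bound differences-≈)

      sum-≈ : ∀ k → addMod t (proj₁ (S k)) (proj₂ (S k)) ≈ suc β * A k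
      sum-≈ k = ≈-trans (%-≈ _) (+-cong (%-≈ (A k)) (%-≈ (β * A k)))

      -- S_β is strong when β ≤ t+1: then 1 + β ≉ 0 for t ≥ 2 (while t = 1
      -- leaves a single pair), so distinct sums come from distinct powers
      strong : β ≤ suc t → IsStrong t S
      strong β≤ i j sums≡ with 2 ≤? t
      ... | no  2≰t = Fin-subsingleton (≤-pred (≰⇒> 2≰t)) i j
      ... | yes 2≤t = pow-injective i j (*-cancelˡ 1+β≉0
                        (≈-trans (≈-sym (sum-≈ i)) (≈-trans (≈-reflexive sums≡) (sum-≈ j))))
        where
          t+2≤2t : 2 + t ≤ 2 * t
          t+2≤2t = ≤-trans (+-monoˡ-≤ t 2≤t) (≤-reflexive (cong (t +_) (sym (+-identityʳ t))))
          1+β≉0 : suc β ≉ 0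
          1+β≉0 = small-nonzero (s≤s z≤n) (s≤s (≤-trans (s≤s β≤) t+2≤2t))

    module _ (m : ℕ) (t≡ : t ≡ suc (2 * (2 * m))) where

      -- −1 is a non-residue since t is odd
      N-nonResidue : NonResidue N
      N-nonResidue = nonResidue-by-power N≉0 (subst (λ s → N ^ s ≈ N) (sym t≡) (N^odd (2 * m)))

      -- 2 is a non-residue: by Gauss' lemma 2^t ≈ (−1)^(2m+1) = −1
      2-nonResidue : NonResidue 2
      2-nonResidue = nonResidue-by-power (small-nonzero (s≤s z≤n) (s≤s 2≤N))
                                         (≈-trans (two^t (2 * m) t≡) (N^odd m))

      2*half≈1 : 2 * suc t ≈ 1
      2*half≈1 = ≈-trans (≈-reflexive (double t)) (≈-trans (+-congˡ 1 q≈0) (≈-reflexive (+-identityʳ 1)))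
        where
          double : ∀ t → 2 * suc t ≡ 1 + suc (2 * t)
          double = solve-∀

      half-nonResidue : NonResidue (suc t)
      half-nonResidue = small-nonzero (s≤s z≤n) half<q , λ half∈⟨α⟩ → proj₂ 2-nonResidue (twice half∈⟨α⟩)
        where
          half<q : suc t < ord t
          half<q = s≤s (≤-trans (+-monoˡ-≤ t 1≤t) (≤-reflexive (cong (t +_) (sym (+-identityʳ t)))))
          twice : IsPow (suc t) → IsPow 2
          twice (k , αᵏ≈half) = pow-quotient 0 k (≈-trans (*-congˡ 2 αᵏ≈half) 2*half≈1)

      -- the k-th pair of S_2 is {u, 2u} with u ≈ α^k
      skolem-2 : IsSkolem t (Sβ t α 2)
      skolem-2 = skolem-by-signedLengths (Sβ t α 2) 1≉0 N-nonResidue λ k →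
        doubled-length 1≉0 (m%n<n (A k) (ord t)) (m%n<n (2 * A k) (ord t))
          (≈-trans (%-≈ (A k)) (≈-reflexive (sym (*-identityˡ (A k)))))
          (≈-trans (%-≈ (2 * A k)) (*-congˡ 2 (≈-sym (%-≈ (A k)))))

      -- the k-th pair of S_(t+1) is {2u, u} with u ≈ (t+1)·α^k
      skolem-half : IsSkolem t (Sβ t α (suc t))
      skolem-half = skolem-by-signedLengths (Sβ t α (suc t)) (proj₁ half-nonResidue) N-nonResidue λ k →
        swapped (doubled-length (proj₁ half-nonResidue) (m%n<n (suc t * A k) (ord t)) (m%n<n (A k) (ord t))
                                (%-≈ (suc t * A k)) (twice-half k))
        where
          twice-half : ∀ k → A k % ord t ≈ 2 * ((suc t * A k) % ord t)
          twice-half k = begin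
            A k % ord t                   ≈⟨ %-≈ (A k) ⟩
            A k                           ≡⟨ *-identityˡ (A k) ⟨
            1 * A k                       ≈⟨ *-congʳ (A k) 2*half≈1 ⟨
            2 * suc t * A k               ≡⟨ *-assoc 2 (suc t) (A k) ⟩
            2 * (suc t * A k)             ≈⟨ *-congˡ 2 (%-≈ (suc t * A k)) ⟨
            2 * ((suc t * A k) % ord t)   ∎
            where open ≈-Reasoning

      strongSkolemStarter : ∀ β → β ≡ 2 ⊎ β ≡ suc t → IsStrongSkolemStarter t (Sβ t α β)
      strongSkolemStarter .2 (inj₁ refl) =
        Family.starter 2 2-nonResidue N-nonResidue , Family.strong 2 (s≤s 1≤t) , skolem-2
      strongSkolemStarter .(suc t) (inj₂ refl) =
        Family.starter (suc t) half-nonResidue N-nonResidue , Family.strong (suc t) ≤-refl , skolem-half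

mainTheorem1 : (t : ℕ) → Prime (ord t) → ord t % 8 ≡ 3 →
    (α : ℕ) → α < ord t → IsQRGenerator t α →
    (β : ℕ) → (β ≡ 2 ⊎ β ≡ (ord t + 1) / 2) →
    IsStrongSkolemStarter t (Sβ t α β)
mainTheorem1 t q-prime q%8≡3 α _ generator β β-choice =
  strongSkolemStarter (ord t / 8) (t≡4m+1 t q%8≡3) β (map₂ (λ β≡ → trans β≡ (half≡suc t)) β-choice)
  where open OddPrime.Generator t q-prime α generator
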